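{- Let $k\ge 1$ be an integer. Every digraph $D\in D(k,k)$ with $m$ edges has a subgraph belonging to $D(k-1,k-1)$ with at least $(2k-1)m/(2k+1)$ edges.
   Context: All digraphs are finite, without loops and without parallel edges. For integers $k,\ell\ge 0$, $D(k,\ell)$ denotes the family of digraphs in which every vertex $v$ satisfies $d^-(v)\le k$ or $d^+(v)\le \ell$ (indegree at most $k$ or outdegree at most $\ell$). A subgraph of $D$ here means a digraph on vertex set $V(D)$ whose edge set is a subset of $E(D)$. -}

module Defs where

open import Data.Nat using (ℕ; _≤_)
open import Data.Fin using (Fin)
open import Data.Fin.Properties using (_≟_)
open import Data.Product using (_×_; proj₁; proj₂; _,_)
open import Data.Sum using (_⊎_)
open import Data.List using (List; length; filter)
open import Data.List.Relation.Unary.All using (All)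
open import Data.List.Relation.Unary.Unique.Propositional using (Unique)
open import Data.List.Membership.Propositional using (_∈_)
open import Relation.Binary.PropositionalEquality using (_≡_; _≢_)

-- An edge (arc) of a digraph on vertex set Fin n: (tail , head).
Edge : ℕ → Set
Edge n = Fin n × Fin n

record Digraph (n : ℕ) : Set where
  constructor digraph
  field
    edges    : List (Edge n)
    loopless : All (λ e → proj₁ e ≢ proj₂ e) edges
    simple   : Unique edges
open Digraph public

size : ∀ {n} → Digraph n → ℕ
size D = length (edges D)

indeg : ∀ {n} → Digraph n → Fin n → ℕ
indeg D v = length (filter (λ e → proj₂ e ≟ v) (edges D))

outdeg : ∀ {n} → Digraph n → Fin n → ℕ
outdeg D v = length (filter (λ e → proj₁ e ≟ v) (edges D))

InDkl : ℕ → ℕ → ∀ {n} → Digraph n → Set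
InDkl k ℓ {n} D = (v : Fin n) → indeg D v ≤ k ⊎ outdeg D v ≤ ℓ

_⊑_ : ∀ {n} → Digraph n → Digraph n → Set
H ⊑ D = ∀ {e} → e ∈ edges H → e ∈ edges D

module Submission where

-- Write K = k + 1 and call a vertex *bad* when both of its degrees are at
-- least K; the subgraphs in D(k,k) are exactly those without bad vertices.
-- Starting from D ∈ D(K,K) we delete edges one at a time, measuring progress
-- by a potential Ψ = Σ_v weight(v): a good vertex weighs 0, and a bad vertex
-- v weighs 2K·d(v) + bonus(v), where d(v) is its total degree and the bonus
-- counts, on each side on which v is *tight* (degree exactly K), the edges of
-- that side leading to good vertices.
--   * `potential-bound`: Ψ ≤ 4K·m, by charging every edge at most 2K at each end.
--   * `good-deletion`: while a bad vertex exists, some deletion lowers Ψ by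
--     Δ = 2K(2K+1).  The effect of one deletion is estimated in general
--     (modules `Deletion`, `DeletionFrom`); if no deletion were good, a chain
--     of local inequalities around bad tight vertices (module `Stuck`) would
--     exclude every bad vertex.
--   * `repair`: iterating good deletions deletes r edges with Δ·r ≤ 4K·m,
--     i.e. r ≤ 2m/(2K+1), which is `theorem10`.

open import Defs
open import Data.Nat using (ℕ; zero; suc; _+_; _*_; _≤_; _<_; z≤n; s≤s; s≤s⁻¹; _≤?_)
open import Data.Nat.Tactic.RingSolver using (solve-∀)
open import Data.Nat.Properties
  using ( ≤-refl; ≤-trans; ≤-reflexive; ≤-antisym; ≤∧≢⇒<; ≰⇒>; <⇒≱; n≤0⇒n≡0; m≤m+n; m≤n+m
        ; m≤n⇒∃[o]m+o≡n; +-comm; +-assoc; +-suc; +-identityʳ; +-mono-≤; +-monoˡ-≤; +-monoʳ-≤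
        ; +-cancelˡ-≡; +-cancelˡ-≤; +-cancelʳ-≤; *-comm; *-suc; *-zeroʳ; *-distribˡ-+; *-distribʳ-+
        ; *-cancelˡ-≤; +-0-commutativeMonoid; +-commutativeSemigroup; module ≤-Reasoning )
  renaming (_≟_ to _ℕ-≟_)
open import Data.Bool using (Bool; true; false; _∧_; not; if_then_else_)
open import Data.Bool.Properties using (∧-comm; not-involutive; ¬-not) renaming (_≟_ to _Bool-≟_)
open import Relation.Nullary.Decidable using (dec-true; dec-false)
open import Data.Fin using (Fin; zero; suc)
open import Data.Fin.Properties using (_≟_; any?)
open import Data.List using (List; []; _∷_; length; filter; lookup; removeAt)
open import Data.List.Properties using (length-removeAt′)
open import Data.List.Relation.Unary.All as All using (All; _∷_)
open import Data.List.Relation.Unary.Any as Any using (here; there)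
open import Data.List.Relation.Unary.Any.Properties using (lookup-index)
open import Data.List.Relation.Unary.Unique.Propositional using (Unique)
open import Data.List.Relation.Unary.AllPairs using (_∷_)
open import Data.List.Membership.Propositional using (_∈_)
open import Data.List.Membership.Propositional.Properties using (∈-lookup)
open import Data.Product using (Σ; _×_; _,_; proj₁; proj₂)
open import Data.Sum using (_⊎_; inj₁; inj₂)
open import Data.Empty using (⊥; ⊥-elim)
open import Relation.Binary.PropositionalEquality
open import Relation.Nullary using (Dec; yes; no; does)
open import Relation.Unary using (Decidable)
open import Algebra.Properties.CommutativeSemigroup +-commutativeSemigroup using (interchange; x∙yz≈y∙xz; x∙yz≈y∙zx)
open import Algebra.Properties.CommutativeMonoid.Sum +-0-commutativeMonoid
  using (sum; sum-cong-≗; ∑-distrib-+; sum-replicate-zero)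

𝟙 : Bool → ℕ
𝟙 true  = 1
𝟙 false = 0

sumL : {A : Set} → (A → ℕ) → List A → ℕ
sumL f []       = 0
sumL f (x ∷ xs) = f x + sumL f xs

count : {A : Set} → (A → Bool) → List A → ℕ
count P = sumL (λ x → 𝟙 (P x))

module _ {A : Set} where

  sumL-mono : {f g : A → ℕ} (L : List A) → (∀ x → x ∈ L → f x ≤ g x) → sumL f L ≤ sumL g L
  sumL-mono []      _ = z≤n
  sumL-mono (x ∷ L) h = +-mono-≤ (h x (here refl)) (sumL-mono L (λ y p → h y (there p)))

  sumL-cong : {f g : A → ℕ} (L : List A) → (∀ x → x ∈ L → f x ≡ g x) → sumL f L ≡ sumL g L
  sumL-cong []      _ = refl
  sumL-cong (x ∷ L) h = cong₂ _+_ (h x (here refl)) (sumL-cong L (λ y p → h y (there p)))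

  sumL-+ : (f g : A → ℕ) (L : List A) → sumL (λ x → f x + g x) L ≡ sumL f L + sumL g L
  sumL-+ f g []      = refl
  sumL-+ f g (x ∷ L) =
    trans (cong (f x + g x +_) (sumL-+ f g L)) (interchange (f x) (g x) (sumL f L) (sumL g L))

  sumL-removeAt : (f : A → ℕ) (L : List A) (i : Fin (length L)) →
                  sumL f L ≡ f (lookup L i) + sumL f (removeAt L i)
  sumL-removeAt f (x ∷ L) zero    = refl
  sumL-removeAt f (x ∷ L) (suc i) =
    trans (cong (f x +_) (sumL-removeAt f L i)) (x∙yz≈y∙xz (f x) (f (lookup L i)) _)

  sumL-const : (c : ℕ) (L : List A) → sumL (λ _ → c) L ≡ length L * c
  sumL-const c []      = refl
  sumL-const c (x ∷ L) = cong (c +_) (sumL-const c L)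

  length-filter≡count : {Q : A → Set} (Q? : Decidable Q) (L : List A) →
                        length (filter Q? L) ≡ count (λ x → does (Q? x)) L
  length-filter≡count Q? []      = refl
  length-filter≡count Q? (x ∷ L) with does (Q? x)
  ... | true  = cong suc (length-filter≡count Q? L)
  ... | false = length-filter≡count Q? L

  count-if : (P : A → Bool) (c : ℕ) (L : List A) →
             sumL (λ x → if P x then c else 0) L ≡ c * count P L
  count-if P c []      = sym (*-zeroʳ c)
  count-if P c (x ∷ L) with P x
  ... | true  = trans (cong (c +_) (count-if P c L)) (sym (*-suc c (count P L)))
  ... | false = count-if P c L

does-true⇒ : {P : Set} (d : Dec P) → does d ≡ true → P
does-true⇒ (yes p) _ = p

∧-true⇒ : {a b : Bool} → a ∧ b ≡ true → a ≡ true × b ≡ true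
∧-true⇒ {true} {true} _ = refl , refl

true-∧ : {a b : Bool} → a ≡ true → b ≡ true → a ∧ b ≡ true
true-∧ refl refl = refl

if-true : {A : Set} {b : Bool} {x y : A} → b ≡ true → (if b then x else y) ≡ x
if-true refl = refl

if-false : {A : Set} {b : Bool} {x y : A} → b ≡ false → (if b then x else y) ≡ y
if-false refl = refl

false≢true : false ≢ true
false≢true ()

module _ {A : Set} where

  count-witness : (P : A → Bool) (L : List A) → 1 ≤ count P L → Σ A (λ e → e ∈ L × P e ≡ true)
  count-witness P (x ∷ L) h with P x in eq
  ... | true  = x , here refl , eq
  ... | false with count-witness P L h
  ...   | e , e∈L , Pe = e , there e∈L , Pe

  count-≥1 : (P : A → Bool) {e : A} (L : List A) → e ∈ L → P e ≡ true → 1 ≤ count P L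
  count-≥1 P (x ∷ L) (here refl) Pe rewrite Pe = s≤s z≤n
  count-≥1 P (x ∷ L) (there e∈L) Pe = ≤-trans (count-≥1 P L e∈L Pe) (m≤n+m _ (𝟙 (P x)))

  count-none : (P : A → Bool) (L : List A) → (∀ e → e ∈ L → P e ≡ true → ⊥) → count P L ≡ 0
  count-none P []      h = refl
  count-none P (x ∷ L) h with P x in eq
  ... | true  = ⊥-elim (h x (here refl) eq)
  ... | false = count-none P L (λ e e∈L → h e (there e∈L))

  count-mono : (P Q : A → Bool) (L : List A) →
               (∀ e → e ∈ L → P e ≡ true → Q e ≡ true) → count P L ≤ count Q L
  count-mono P Q L h = sumL-mono L (λ e e∈L → 𝟙-mono (h e e∈L))
    where
    𝟙-mono : {a b : Bool} → (a ≡ true → b ≡ true) → 𝟙 a ≤ 𝟙 b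
    𝟙-mono {false} _ = z≤n
    𝟙-mono {true}  h rewrite h refl = s≤s z≤n

  count-∨ : (P Q R : A → Bool) (L : List A) →
            (∀ e → e ∈ L → P e ≡ true → Q e ≡ true ⊎ R e ≡ true) →
            count P L ≤ count Q L + count R L
  count-∨ P Q R L h =
    ≤-trans (sumL-mono L pointwise) (≤-reflexive (sumL-+ (λ e → 𝟙 (Q e)) (λ e → 𝟙 (R e)) L))
    where
    pointwise : ∀ e → e ∈ L → 𝟙 (P e) ≤ 𝟙 (Q e) + 𝟙 (R e)
    pointwise e e∈L with P e in eq
    ... | false = z≤n
    ... | true with h e e∈L eq
    ...   | inj₁ Qe rewrite Qe = s≤s z≤n
    ...   | inj₂ Re rewrite Re = m≤n+m 1 (𝟙 (Q e))

  count-split : (P Q : A → Bool) (L : List A) →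
                count P L ≡ count (λ e → P e ∧ Q e) L + count (λ e → P e ∧ not (Q e)) L
  count-split P Q L =
    trans (sumL-cong L pointwise) (sumL-+ (λ e → 𝟙 (P e ∧ Q e)) (λ e → 𝟙 (P e ∧ not (Q e))) L)
    where
    pointwise : ∀ e → e ∈ L → 𝟙 (P e) ≡ 𝟙 (P e ∧ Q e) + 𝟙 (P e ∧ not (Q e))
    pointwise e _ with P e | Q e
    ... | true  | true  = refl
    ... | true  | false = refl
    ... | false | _     = refl

  count-refine-full : (P R : A → Bool) (L : List A) → count (λ e → P e ∧ R e) L ≡ count P L →
                      ∀ e → e ∈ L → P e ≡ true → R e ≡ true
  count-refine-full P R L eq e e∈L Pe with R e in Re
  ... | true  = refl
  ... | false = ⊥-elim (<⇒≱ (count-≥1 (λ e → P e ∧ not (R e)) L e∈L (true-∧ Pe (cong not Re)))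
                             (≤-reflexive rest≡0))
    where
    rest≡0 : count (λ e → P e ∧ not (R e)) L ≡ 0
    rest≡0 = +-cancelˡ-≡ (count (λ e → P e ∧ R e) L) _ _
               (trans (sym (count-split P R L)) (trans (sym eq) (sym (+-identityʳ _))))

  count-removeAt : (P : A → Bool) (L : List A) (i : Fin (length L)) →
                   count P (removeAt L i) ≤ count P L
  count-removeAt P L i =
    ≤-trans (m≤n+m _ (𝟙 (P (lookup L i)))) (≤-reflexive (sym (sumL-removeAt (λ e → 𝟙 (P e)) L i)))

module _ {A : Set} where

  ∈-removeAt⁻ : {e : A} (L : List A) (i : Fin (length L)) → e ∈ removeAt L i → e ∈ L
  ∈-removeAt⁻ (x ∷ L) zero    e∈     = there e∈
  ∈-removeAt⁻ (x ∷ L) (suc i) (here p)  = here p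
  ∈-removeAt⁻ (x ∷ L) (suc i) (there p) = there (∈-removeAt⁻ L i p)

  All-removeAt : {P : A → Set} (L : List A) (i : Fin (length L)) → All P L → All P (removeAt L i)
  All-removeAt (x ∷ L) zero    (px ∷ ps) = ps
  All-removeAt (x ∷ L) (suc i) (px ∷ ps) = px ∷ All-removeAt L i ps

  index-of : {e : A} {L : List A} → e ∈ L → Σ (Fin (length L)) (λ i → lookup L i ≡ e)
  index-of e∈L = Any.index e∈L , sym (lookup-index e∈L)

  Unique-removeAt : (L : List A) (i : Fin (length L)) → Unique L → Unique (removeAt L i)
  Unique-removeAt (x ∷ L) zero    (_  ∷ u) = u
  Unique-removeAt (x ∷ L) (suc i) (px ∷ u) = All-removeAt L i px ∷ Unique-removeAt L i u

  Unique-removeAt-≢ : {e : A} (L : List A) (i : Fin (length L)) → Unique L →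
                      e ∈ removeAt L i → e ≢ lookup L i
  Unique-removeAt-≢ (x ∷ L) zero    (px ∷ u) e∈ refl = All.lookup px e∈ refl
  Unique-removeAt-≢ (x ∷ L) (suc i) (px ∷ u) (here refl) refl = All.lookup px (∈-lookup i) refl
  Unique-removeAt-≢ (x ∷ L) (suc i) (px ∷ u) (there e∈) = Unique-removeAt-≢ L i u e∈

sum-mono : ∀ {m} {f g : Fin m → ℕ} → (∀ i → f i ≤ g i) → sum f ≤ sum g
sum-mono {zero}  h = z≤n
sum-mono {suc m} h = +-mono-≤ (h zero) (sum-mono (λ i → h (suc i)))

at : ∀ {m} → Fin m → ℕ → Fin m → ℕ
at x a v = if does (x ≟ v) then a else 0

sum-at : ∀ {m} (x : Fin m) (a : ℕ) → sum (at x a) ≡ a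
sum-at {suc m} zero    a = trans (cong (a +_) (sum-replicate-zero m)) (+-identityʳ a)
sum-at {suc m} (suc x) a = sum-at x a

sum-sumL : ∀ {m} {A : Set} (g : A → Fin m → ℕ) (L : List A) →
           sum (λ v → sumL (λ e → g e v) L) ≡ sumL (λ e → sum (g e)) L
sum-sumL {m} g []      = sum-replicate-zero m
sum-sumL     g (x ∷ L) =
  trans (∑-distrib-+ (g x) (λ v → sumL (λ e → g e v) L)) (cong (sum (g x) +_) (sum-sumL g L))

sum-count-at : ∀ {m} {A : Set} (f : A → Fin m) (Q : A → Bool) (L : List A) →
               sum (λ v → count (λ e → does (f e ≟ v) ∧ Q e) L) ≡ count Q L
sum-count-at f Q L =
  trans (sum-sumL (λ e v → 𝟙 (does (f e ≟ v) ∧ Q e)) L)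
        (sumL-cong L (λ e _ → trans (sum-cong-≗ (pointwise (f e) (Q e))) (sum-at (f e) (𝟙 (Q e)))))
  where
  pointwise : ∀ {m} (u : Fin m) (b : Bool) v → 𝟙 (does (u ≟ v) ∧ b) ≡ at u (𝟙 b) v
  pointwise u b v with does (u ≟ v)
  ... | true  = refl
  ... | false = refl

sum-mono-except₂ : ∀ {m} (f' f h : Fin m → ℕ) (x w : Fin m) (a b c d : ℕ) → x ≢ w →
  (∀ v → x ≢ v → w ≢ v → f' v ≤ f v + h v) →
  f' x + a ≤ (f x + h x) + c → f' w + b ≤ (f w + h w) + d →
  sum f' + (a + b) ≤ (sum f + sum h) + (c + d)
sum-mono-except₂ f' f h x w a b c d x≢w elsewhere at-x at-w =
  subst₂ _≤_ lhs rhs (sum-mono pointwise)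
  where
  pointwise : ∀ v → f' v + (at x a v + at w b v) ≤ (f v + h v) + (at x c v + at w d v)
  pointwise v with x ≟ v | w ≟ v
  ... | yes refl | yes w≡x = ⊥-elim (x≢w (sym w≡x))
  ... | yes refl | no _    = subst₂ _≤_ (cong (f' x +_) (sym (+-identityʳ a)))
                                        (cong ((f x + h x) +_) (sym (+-identityʳ c))) at-x
  ... | no _     | yes refl = at-w
  ... | no x≢v   | no w≢v   = subst₂ _≤_ (sym (+-identityʳ (f' v))) (sym (+-identityʳ (f v + h v)))
                                        (elsewhere v x≢v w≢v)
  lhs : sum (λ v → f' v + (at x a v + at w b v)) ≡ sum f' + (a + b)
  lhs = trans (∑-distrib-+ f' (λ v → at x a v + at w b v))
          (cong (sum f' +_) (trans (∑-distrib-+ (at x a) (at w b)) (cong₂ _+_ (sum-at x a) (sum-at w b))))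
  rhs : sum (λ v → (f v + h v) + (at x c v + at w d v)) ≡ (sum f + sum h) + (c + d)
  rhs = trans (∑-distrib-+ (λ v → f v + h v) (λ v → at x c v + at w d v))
          (cong₂ _+_ (∑-distrib-+ f h)
                     (trans (∑-distrib-+ (at x c) (at w d)) (cong₂ _+_ (sum-at x c) (sum-at w d))))

-- The two sides of an edge: its source (tail) and its target (head).  The
-- degree of v on side s counts the edges whose s-end is v, so `tgt` gives the
-- in-degree and `src` the out-degree.

data Side : Set where
  src tgt : Side

opp : Side → Side
opp src = tgt
opp tgt = src

opp-involutive : ∀ s → opp (opp s) ≡ s
opp-involutive src = refl
opp-involutive tgt = refl

end : ∀ {n} → Side → Edge n → Fin n
end src = proj₁
end tgt = proj₂

bothSides : (Side → ℕ) → ℕ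
bothSides f = f tgt + f src

bothSides-from : ∀ s (f : Side → ℕ) → bothSides f ≡ f s + f (opp s)
bothSides-from tgt f = refl
bothSides-from src f = +-comm (f tgt) (f src)

module _ {n : ℕ} where

  ends-determine : ∀ s (e e' : Edge n) → end s e ≡ end s e' → end (opp s) e ≡ end (opp s) e' → e ≡ e'
  ends-determine tgt (a , b) (a' , b') p q = cong₂ _,_ q p
  ends-determine src (a , b) (a' , b') p q = cong₂ _,_ p q

  ends-differ : (e : Edge n) → proj₁ e ≢ proj₂ e → ∀ s → end s e ≢ end (opp s) e
  ends-differ e loopless tgt p = loopless (sym p)
  ends-differ e loopless src p = loopless p

  ends-cover : ∀ s σ (e : Edge n) → end σ e ≡ end s e ⊎ end σ e ≡ end (opp s) e
  ends-cover src src e = inj₁ refl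
  ends-cover src tgt e = inj₂ refl
  ends-cover tgt src e = inj₂ refl
  ends-cover tgt tgt e = inj₁ refl

-- Rearranging the weight of a vertex that loses one edge (t stands for 2K).
weight-shift : ∀ t A a₁ a₂ b₁ b₂ c₁ c₂ d → a₁ ≤ b₁ + c₁ → a₂ ≤ d + c₂ →
               A + (a₁ + a₂) + t ≤ ((t + A + (b₁ + b₂)) + (c₁ + c₂)) + d
weight-shift t A a₁ a₂ b₁ b₂ c₁ c₂ d a₁≤ a₂≤ = begin
  A + (a₁ + a₂) + t                        ≤⟨ +-monoˡ-≤ t (+-monoʳ-≤ A (+-mono-≤ a₁≤ a₂≤)) ⟩
  A + ((b₁ + c₁) + (d + c₂)) + t           ≡⟨ rearrange A b₁ c₁ d c₂ t ⟩
  ((t + A + (b₁ + 0)) + (c₁ + c₂)) + d     ≤⟨ +-monoˡ-≤ d (+-monoˡ-≤ (c₁ + c₂) (+-monoʳ-≤ (t + A) (+-monoʳ-≤ b₁ z≤n))) ⟩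
  ((t + A + (b₁ + b₂)) + (c₁ + c₂)) + d    ∎
  where
  open ≤-Reasoning
  rearrange : ∀ A b₁ c₁ d c₂ t → A + ((b₁ + c₁) + (d + c₂)) + t ≡ ((t + A + (b₁ + 0)) + (c₁ + c₂)) + d
  rearrange = solve-∀

module Potential (k n : ℕ) where

  K twoK Δ : ℕ
  K    = suc k
  twoK = K + K
  -- the decrease of the potential achieved by each deletion
  Δ    = twoK * (twoK + 1)

  Edges : Set
  Edges = List (Edge n)

  deg : Edges → Side → Fin n → ℕ
  deg L s v = count (λ e → does (end s e ≟ v)) L

  isBad isGood : Edges → Fin n → Bool
  isBad  L v = does (K ≤? deg L tgt v) ∧ does (K ≤? deg L src v)
  isGood L v = not (isBad L v)

  isTight : Edges → Side → Fin n → Bool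
  isTight L s v = does (deg L s v ℕ-≟ K)

  goodEdges : Edges → Side → Fin n → ℕ
  goodEdges L s v = count (λ e → does (end s e ≟ v) ∧ isGood L (end (opp s) e)) L

  badEdges : Edges → Side → Fin n → ℕ
  badEdges L s u = count (λ e → does (end s e ≟ u) ∧ isBad L (end (opp s) e)) L

  deg-split : ∀ L s u → deg L s u ≡ badEdges L s u + goodEdges L s u
  deg-split L s u = count-split (λ e → does (end s e ≟ u)) (λ e → isBad L (end (opp s) e)) L

  bonusAt : Edges → Side → Fin n → ℕ
  bonusAt L s v = if isTight L s v then goodEdges L s v else 0

  bonus totdeg weight : Edges → Fin n → ℕ
  bonus  L v = bothSides (λ s → bonusAt L s v)
  totdeg L v = bothSides (λ s → deg L s v)
  weight L v = if isBad L v then twoK * totdeg L v + bonus L v else 0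

  Ψ : Edges → ℕ
  Ψ L = sum (weight L)

  weight-bad : ∀ L v → isBad L v ≡ true → weight L v ≡ twoK * totdeg L v + bonus L v
  weight-bad L v = if-true

  weight-good : ∀ L v → isBad L v ≡ false → weight L v ≡ 0
  weight-good L v = if-false

  isBad-from : ∀ L s v → isBad L v ≡ does (K ≤? deg L s v) ∧ does (K ≤? deg L (opp s) v)
  isBad-from L tgt v = refl
  isBad-from L src v = ∧-comm (does (K ≤? deg L tgt v)) (does (K ≤? deg L src v))

  bad⇒K≤deg : ∀ L v → isBad L v ≡ true → ∀ s → K ≤ deg L s v
  bad⇒K≤deg L v bad s = does-true⇒ (K ≤? deg L s v) (proj₁ (∧-true⇒ (trans (sym (isBad-from L s v)) bad)))

  K≤deg⇒bad : ∀ L v s → K ≤ deg L s v → K ≤ deg L (opp s) v → isBad L v ≡ true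
  K≤deg⇒bad L v s p q = trans (isBad-from L s v) (true-∧ (dec-true (K ≤? _) p) (dec-true (K ≤? _) q))

  deg<K⇒good : ∀ L v s → deg L s v < K → isBad L v ≡ false
  deg<K⇒good L v s small with isBad L v in bad
  ... | false = refl
  ... | true  = ⊥-elim (<⇒≱ small (bad⇒K≤deg L v bad s))

  good⇒deg<K : ∀ L v → isBad L v ≡ false → Σ Side (λ s → deg L s v < K)
  good⇒deg<K L v good with K ≤? deg L tgt v | K ≤? deg L src v
  ... | no p  | _     = tgt , ≰⇒> p
  ... | yes _ | no q  = src , ≰⇒> q
  ... | yes p | yes q = ⊥-elim (false≢true (trans (sym good) (K≤deg⇒bad L v tgt p q)))

  -- Two ends of total degree at least 2K each carry weight covering Δ.
  double-deletion-arith : ∀ p q → twoK ≤ suc p → twoK ≤ suc q → Δ + (p + q) ≤ twoK * suc p + twoK * suc q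
  double-deletion-arith p q big-p big-q with m≤n⇒∃[o]m+o≡n (s≤s⁻¹ big-p) | m≤n⇒∃[o]m+o≡n (s≤s⁻¹ big-q)
  ... | t₁ , refl | t₂ , refl = ≤-trans (m≤m+n _ _) (≤-reflexive (identity k t₁ t₂))
    where
    identity : ∀ k t₁ t₂ →
      (suc k + suc k) * (suc k + suc k + 1) + ((k + suc k + t₁) + (k + suc k + t₂))
        + (k * k * 4 + k * 2 + (k * 2 + 1) * (t₁ + t₂))
      ≡ (suc k + suc k) * suc (k + suc k + t₁) + (suc k + suc k) * suc (k + suc k + t₂)
    identity = solve-∀

  K<twoK : suc K ≤ twoK
  K<twoK = s≤s (m≤n+m (suc k) k)

  Δ-from-degrees : twoK * (K + suc K) ≡ Δ
  Δ-from-degrees = identity k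
    where
    identity : ∀ k → (suc k + suc k) * (suc k + suc (suc k)) ≡ (suc k + suc k) * ((suc k + suc k) + 1)
    identity = solve-∀

  Δ-from-balanced : twoK * (K + K) + twoK ≡ Δ
  Δ-from-balanced = identity k
    where
    identity : ∀ k → (suc k + suc k) * (suc k + suc k) + (suc k + suc k) ≡ (suc k + suc k) * ((suc k + suc k) + 1)
    identity = solve-∀

  heavy : ∀ d → suc (suc K) ≤ d → Δ + d ≤ twoK * (K + d) + 1 × Δ + (d + K) ≤ twoK * (K + d) + twoK
  heavy d big with m≤n⇒∃[o]m+o≡n big
  ... | t , refl = ≤-trans (m≤m+n _ _) (≤-reflexive (identity₁ k t)) ,
                   ≤-trans (m≤m+n _ _) (≤-reflexive (identity₂ k t))
    where
    identity₁ : ∀ k t → (suc k + suc k) * ((suc k + suc k) + 1) + (suc (suc (suc k)) + t) + (k + (k * 2 + 1) * t)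
                        ≡ (suc k + suc k) * (suc k + (suc (suc (suc k)) + t)) + 1
    identity₁ = solve-∀
    identity₂ : ∀ k t → (suc k + suc k) * ((suc k + suc k) + 1) + ((suc (suc (suc k)) + t) + suc k) + (k * 2 + (k * 2 + 1) * t)
                        ≡ (suc k + suc k) * (suc k + (suc (suc (suc k)) + t)) + (suc k + suc k)
    identity₂ = solve-∀

  -- If a deletion lowers Ψ by less than Δ, the gain A it certifies is
  -- smaller than Δ plus the loss B.
  deletion-gap : ∀ {P P′ A B} → P < P′ + Δ → P′ + A ≤ P + B → A < Δ + B
  deletion-gap {P} {P′} {A} {B} stuck bound = +-cancelˡ-≤ P′ _ _ (begin
    P′ + suc A      ≡⟨ +-suc P′ A ⟩
    suc (P′ + A)    ≤⟨ s≤s bound ⟩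
    suc P + B       ≤⟨ +-monoˡ-≤ B stuck ⟩
    P′ + Δ + B      ≡⟨ +-assoc P′ Δ B ⟩
    P′ + (Δ + B)    ∎)
    where open ≤-Reasoning

  -- Deleting the i-th edge e₀ of L lowers the degrees of
  -- its ends by one and leaves all other degrees unchanged; the weight of a
  -- vertex v not incident to e₀ can only grow through its bonus, when some
  -- neighbour of v becomes good.  That growth is bounded by `correction v`.

  module Deletion (L : Edges) (i : Fin (length L)) where

    e₀ : Edge n
    e₀ = lookup L i

    L⁻ : Edges
    L⁻ = removeAt L i

    deg-removeAt : ∀ s v → deg L s v ≡ 𝟙 (does (end s e₀ ≟ v)) + deg L⁻ s v
    deg-removeAt s v = sumL-removeAt (λ e → 𝟙 (does (end s e ≟ v))) L i

    deg-away : ∀ s v → end s e₀ ≢ v → deg L s v ≡ deg L⁻ s v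
    deg-away s v ne = trans (deg-removeAt s v) (cong (λ b → 𝟙 b + deg L⁻ s v) (dec-false (end s e₀ ≟ v) ne))

    deg-end : ∀ s → deg L s (end s e₀) ≡ suc (deg L⁻ s (end s e₀))
    deg-end s = trans (deg-removeAt s (end s e₀))
                      (cong (λ b → 𝟙 b + deg L⁻ s (end s e₀)) (dec-true (end s e₀ ≟ end s e₀) refl))

    deg-≤ : ∀ s v → deg L⁻ s v ≤ deg L s v
    deg-≤ s v = ≤-trans (m≤n+m _ (𝟙 (does (end s e₀ ≟ v)))) (≤-reflexive (sym (deg-removeAt s v)))

    isBad-removeAt : ∀ v → isBad L⁻ v ≡ true → isBad L v ≡ true
    isBad-removeAt v bad = K≤deg⇒bad L v tgt (≤-trans (bad⇒K≤deg L⁻ v bad tgt) (deg-≤ tgt v))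
                                               (≤-trans (bad⇒K≤deg L⁻ v bad src) (deg-≤ src v))

    Away : Fin n → Set
    Away v = ∀ s → end s e₀ ≢ v

    isBad-away : ∀ v → Away v → isBad L v ≡ isBad L⁻ v
    isBad-away v away = cong₂ (λ a b → does (K ≤? a) ∧ does (K ≤? b))
                              (deg-away tgt v (away tgt)) (deg-away src v (away src))

    isTight-away : ∀ σ v → Away v → isTight L σ v ≡ isTight L⁻ σ v
    isTight-away σ v away = cong (λ a → does (a ℕ-≟ K)) (deg-away σ v (away σ))

    newlyGood : Fin n → Bool
    newlyGood u = isBad L u ∧ isGood L⁻ u

    newlyGoodEdges : Side → Fin n → ℕ
    newlyGoodEdges σ v = count (λ e → does (end σ e ≟ v) ∧ newlyGood (end (opp σ) e)) L⁻

    goodEdges-removeAt : ∀ σ v → goodEdges L⁻ σ v ≤ goodEdges L σ v + newlyGoodEdges σ v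
    goodEdges-removeAt σ v = ≤-trans (count-∨ _ Q _ L⁻ good-or-newly) (+-monoˡ-≤ _ (count-removeAt Q L i))
      where
      Q : Edge n → Bool
      Q e = does (end σ e ≟ v) ∧ isGood L (end (opp σ) e)
      good-or-newly : ∀ e → e ∈ L⁻ → does (end σ e ≟ v) ∧ isGood L⁻ (end (opp σ) e) ≡ true →
                      Q e ≡ true ⊎ (does (end σ e ≟ v) ∧ newlyGood (end (opp σ) e)) ≡ true
      good-or-newly e _ at-v with ∧-true⇒ at-v | isBad L (end (opp σ) e)
      ... | at , good | true  = inj₂ (true-∧ at good)
      ... | at , _    | false = inj₁ (true-∧ at refl)

    correctionAt : Side → Fin n → ℕ
    correctionAt σ v = if isBad L⁻ v ∧ isTight L⁻ σ v then newlyGoodEdges σ v else 0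

    correction : Fin n → ℕ
    correction v = bothSides (λ σ → correctionAt σ v)

    Feeds : Side → Edge n → Bool
    Feeds σ e = (isBad L⁻ (end σ e) ∧ isTight L⁻ σ (end σ e)) ∧ newlyGood (end (opp σ) e)

    correctionAt-count : ∀ σ v → correctionAt σ v ≡ count (λ e → does (end σ e ≟ v) ∧ Feeds σ e) L⁻
    correctionAt-count σ v with isBad L⁻ v ∧ isTight L⁻ σ v in bad-tight
    ... | true  = sumL-cong L⁻ (λ e _ → cong 𝟙 (pointwise e))
      where
      pointwise : ∀ e → does (end σ e ≟ v) ∧ newlyGood (end (opp σ) e) ≡ does (end σ e ≟ v) ∧ Feeds σ e
      pointwise e with end σ e ≟ v
      ... | yes refl rewrite bad-tight = refl
      ... | no _     = refl
    ... | false = sym (count-none _ L⁻ none)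
      where
      none : ∀ e → e ∈ L⁻ → (does (end σ e ≟ v) ∧ Feeds σ e) ≡ true → ⊥
      none e _ feeds with ∧-true⇒ feeds
      ... | at , feeds′ with does-true⇒ (end σ e ≟ v) at
      ...   | refl = false≢true (trans (sym bad-tight) (proj₁ (∧-true⇒ feeds′)))

    sum-correction : sum correction ≡ bothSides (λ σ → count (Feeds σ) L⁻)
    sum-correction = trans (∑-distrib-+ (correctionAt tgt) (correctionAt src))
      (cong₂ _+_ (trans (sum-cong-≗ (correctionAt-count tgt)) (sum-count-at (end tgt) (Feeds tgt) L⁻))
                 (trans (sum-cong-≗ (correctionAt-count src)) (sum-count-at (end src) (Feeds src) L⁻)))

    bonusAt-removeAt : ∀ σ v → isTight L σ v ≡ isTight L⁻ σ v → isBad L⁻ v ≡ true →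
                       bonusAt L⁻ σ v ≤ bonusAt L σ v + correctionAt σ v
    bonusAt-removeAt σ v same-tight bad = by-tightness (isTight L⁻ σ v) refl
      where
      open ≤-Reasoning
      by-tightness : ∀ t → isTight L⁻ σ v ≡ t → bonusAt L⁻ σ v ≤ bonusAt L σ v + correctionAt σ v
      by-tightness false loose = ≤-trans (≤-reflexive (if-false loose)) z≤n
      by-tightness true  tight = begin
        bonusAt L⁻ σ v                            ≡⟨ if-true tight ⟩
        goodEdges L⁻ σ v                          ≤⟨ goodEdges-removeAt σ v ⟩
        goodEdges L σ v + newlyGoodEdges σ v      ≡⟨ cong₂ _+_ (sym (if-true (trans same-tight tight)))
                                                               (sym (if-true (true-∧ bad tight))) ⟩
        bonusAt L σ v + correctionAt σ v          ∎

    weight-away : ∀ v → Away v → weight L⁻ v ≤ weight L v + correction v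
    weight-away v away = by-badness (isBad L⁻ v) refl
      where
      open ≤-Reasoning
      same-totdeg : totdeg L v ≡ totdeg L⁻ v
      same-totdeg = cong₂ _+_ (deg-away tgt v (away tgt)) (deg-away src v (away src))
      by-badness : ∀ b → isBad L⁻ v ≡ b → weight L⁻ v ≤ weight L v + correction v
      by-badness false good = ≤-trans (≤-reflexive (weight-good L⁻ v good)) z≤n
      by-badness true  bad  = begin
        weight L⁻ v
          ≡⟨ weight-bad L⁻ v bad ⟩
        twoK * totdeg L⁻ v + bonus L⁻ v
          ≤⟨ +-monoʳ-≤ (twoK * totdeg L⁻ v) (≤-trans (+-mono-≤ (bonus-side tgt) (bonus-side src))
                (≤-reflexive (interchange (bonusAt L tgt v) (correctionAt tgt v) _ _))) ⟩
        twoK * totdeg L⁻ v + (bonus L v + correction v)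
          ≡⟨ sym (+-assoc (twoK * totdeg L⁻ v) (bonus L v) (correction v)) ⟩
        twoK * totdeg L⁻ v + bonus L v + correction v
          ≡⟨ cong (λ d → twoK * d + bonus L v + correction v) (sym same-totdeg) ⟩
        twoK * totdeg L v + bonus L v + correction v
          ≡⟨ cong (_+ correction v) (sym (weight-bad L v (trans (isBad-away v away) bad))) ⟩
        weight L v + correction v ∎
        where
        bonus-side : ∀ σ → bonusAt L⁻ σ v ≤ bonusAt L σ v + correctionAt σ v
        bonus-side σ = bonusAt-removeAt σ v (isTight-away σ v away) bad

  Loopless : Edges → Set
  Loopless L = All (λ e → proj₁ e ≢ proj₂ e) L

  -- Seen from side s, e is a double edge when both of its ends are bad and
  -- tight on their side of e: deleting it repairs both ends at once.
  DoubleEdge : Edges → Side → Edge n → Set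
  DoubleEdge L s e = isBad L (end s e) ≡ true × isBad L (end (opp s) e) ≡ true ×
                     deg L s (end s e) ≡ K × deg L (opp s) (end (opp s) e) ≡ K

  NoDoubleEdge : Edges → Set
  NoDoubleEdge L = ∀ s e → e ∈ L → DoubleEdge L s e → ⊥

  tightBadEdges : Edges → Side → Fin n → ℕ
  tightBadEdges L s u = count (λ e → does (end (opp s) e ≟ u) ∧ (isBad L (end s e) ∧ isTight L s (end s e))) L

  -- The deletion of e₀ seen from side s: it lowers the s-degree of x and the
  -- (opp s)-degree of w.  Only x and w can become good, so the correction is
  -- carried by edges at x and w.

  module DeletionFrom (L : Edges) (i : Fin (length L)) (s : Side) (loopless : Loopless L) where
    open Deletion L i public

    x w : Fin n
    x = end s e₀
    w = end (opp s) e₀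

    x≢w : x ≢ w
    x≢w = ends-differ e₀ (All.lookup loopless (∈-lookup i)) s

    away : ∀ v → x ≢ v → w ≢ v → Away v
    away v x≢v w≢v σ with ends-cover s σ e₀
    ... | inj₁ σ-end≡x = λ σ-end≡v → x≢v (trans (sym σ-end≡x) σ-end≡v)
    ... | inj₂ σ-end≡w = λ σ-end≡v → w≢v (trans (sym σ-end≡w) σ-end≡v)

    x-repaired : deg L s x ≡ K → weight L⁻ x ≡ 0
    x-repaired tight = weight-good L⁻ x (deg<K⇒good L⁻ x s (≤-reflexive (sym (trans (sym tight) (deg-end s)))))

    w-repaired : deg L (opp s) w ≡ K → weight L⁻ w ≡ 0
    w-repaired tight =
      weight-good L⁻ w (deg<K⇒good L⁻ w (opp s) (≤-reflexive (sym (trans (sym tight) (deg-end (opp s))))))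

    totdeg-x : totdeg L x ≡ suc (totdeg L⁻ x)
    totdeg-x = begin
      totdeg L x                                ≡⟨ bothSides-from s (λ σ → deg L σ x) ⟩
      deg L s x + deg L (opp s) x               ≡⟨ cong₂ _+_ (deg-end s) (deg-away (opp s) x (λ w≡x → x≢w (sym w≡x))) ⟩
      suc (deg L⁻ s x + deg L⁻ (opp s) x)       ≡⟨ cong suc (sym (bothSides-from s (λ σ → deg L⁻ σ x))) ⟩
      suc (totdeg L⁻ x)                         ∎
      where open ≡-Reasoning

    totdeg-w : totdeg L w ≡ suc (totdeg L⁻ w)
    totdeg-w = begin
      totdeg L w                                ≡⟨ bothSides-from s (λ σ → deg L σ w) ⟩
      deg L s w + deg L (opp s) w               ≡⟨ cong₂ _+_ (deg-away s w x≢w) (deg-end (opp s)) ⟩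
      deg L⁻ s w + suc (deg L⁻ (opp s) w)       ≡⟨ +-suc (deg L⁻ s w) _ ⟩
      suc (deg L⁻ s w + deg L⁻ (opp s) w)       ≡⟨ cong suc (sym (bothSides-from s (λ σ → deg L⁻ σ w))) ⟩
      suc (totdeg L⁻ w)                         ∎
      where open ≡-Reasoning

    newlyGood-end : ∀ u → newlyGood u ≡ true → u ≡ x ⊎ u ≡ w
    newlyGood-end u newly with u ≟ x | u ≟ w
    ... | yes u≡x | _       = inj₁ u≡x
    ... | no _    | yes u≡w = inj₂ u≡w
    ... | no u≢x  | no u≢w  = ⊥-elim (bad-and-good (isBad L⁻ u) (trans (cong (λ b → b ∧ isGood L⁻ u)
                                  (sym (isBad-away u (away u (λ x≡u → u≢x (sym x≡u)) (λ w≡u → u≢w (sym w≡u)))))) newly))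
      where
      bad-and-good : (b : Bool) → b ∧ not b ≡ true → ⊥
      bad-and-good true  ()
      bad-and-good false ()

    -- Comparison of the potentials when x is repaired; the terms b and d
    -- record what happens at w.
    Ψ-removeAt : weight L⁻ x ≡ 0 → (b d : ℕ) → weight L⁻ w + b ≤ (weight L w + correction w) + d →
                 Ψ L⁻ + (weight L x + b) ≤ (Ψ L + sum correction) + (0 + d)
    Ψ-removeAt repaired b d at-w =
      sum-mono-except₂ (weight L⁻) (weight L) correction x w (weight L x) b 0 d x≢w
        (λ v x≢v w≢v → weight-away v (away v x≢v w≢v)) at-x at-w
      where
      at-x : weight L⁻ x + weight L x ≤ (weight L x + correction x) + 0
      at-x rewrite repaired | +-identityʳ (weight L x + correction x) = m≤m+n (weight L x) (correction x)

    Feeds-end : ∀ σ → count (Feeds σ) L⁻ ≤ deg L⁻ (opp σ) x + deg L⁻ (opp σ) w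
    Feeds-end σ = count-∨ (Feeds σ) _ _ L⁻ at-x-or-w
      where
      at-x-or-w : ∀ e → e ∈ L⁻ → Feeds σ e ≡ true →
                  does (end (opp σ) e ≟ x) ≡ true ⊎ does (end (opp σ) e ≟ w) ≡ true
      at-x-or-w e _ feeds with newlyGood-end (end (opp σ) e) (proj₂ (∧-true⇒ {isBad L⁻ (end σ e) ∧ _} feeds))
      ... | inj₁ at-x = inj₁ (dec-true (end (opp σ) e ≟ x) at-x)
      ... | inj₂ at-w = inj₂ (dec-true (end (opp σ) e ≟ w) at-w)

    sum-correction-≤ : sum correction ≤ totdeg L⁻ x + totdeg L⁻ w
    sum-correction-≤ = begin
      sum correction                                          ≡⟨ sum-correction ⟩
      count (Feeds tgt) L⁻ + count (Feeds src) L⁻             ≤⟨ +-mono-≤ (Feeds-end tgt) (Feeds-end src) ⟩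
      (deg L⁻ src x + deg L⁻ src w) + (deg L⁻ tgt x + deg L⁻ tgt w)
        ≡⟨ +-comm (deg L⁻ src x + deg L⁻ src w) _ ⟩
      (deg L⁻ tgt x + deg L⁻ tgt w) + (deg L⁻ src x + deg L⁻ src w)
        ≡⟨ interchange (deg L⁻ tgt x) (deg L⁻ tgt w) (deg L⁻ src x) (deg L⁻ src w) ⟩
      totdeg L⁻ x + totdeg L⁻ w                               ∎
      where open ≤-Reasoning

    private
      bad-end-weight : ∀ u → isBad L u ≡ true → totdeg L u ≡ suc (totdeg L⁻ u) →
                       twoK ≤ suc (totdeg L⁻ u) × twoK * suc (totdeg L⁻ u) ≤ weight L u
      bad-end-weight u bad lost =
        subst (twoK ≤_) lost (+-mono-≤ (bad⇒K≤deg L u bad tgt) (bad⇒K≤deg L u bad src)) ,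
        ≤-trans (≤-reflexive (cong (twoK *_) (sym lost)))
                (≤-trans (m≤m+n _ (bonus L u)) (≤-reflexive (sym (weight-bad L u bad))))

    double-deletion : DoubleEdge L s e₀ → Ψ L⁻ + Δ ≤ Ψ L
    double-deletion (bad-x , bad-w , tight-x , tight-w) = +-cancelʳ-≤ (Dx + Dw) _ _ (begin
      Ψ L⁻ + Δ + (Dx + Dw)                               ≡⟨ +-assoc (Ψ L⁻) Δ _ ⟩
      Ψ L⁻ + (Δ + (Dx + Dw))                             ≤⟨ +-monoʳ-≤ (Ψ L⁻) (double-deletion-arith Dx Dw
                                                              (proj₁ big-x) (proj₁ big-w)) ⟩
      Ψ L⁻ + (twoK * suc Dx + twoK * suc Dw)             ≤⟨ +-monoʳ-≤ (Ψ L⁻) (+-mono-≤ (proj₂ big-x) (proj₂ big-w)) ⟩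
      Ψ L⁻ + (weight L x + weight L w)                   ≤⟨ Ψ-removeAt (x-repaired tight-x) (weight L w) 0 at-w ⟩
      (Ψ L + sum correction) + 0                         ≡⟨ +-identityʳ _ ⟩
      Ψ L + sum correction                               ≤⟨ +-monoʳ-≤ (Ψ L) sum-correction-≤ ⟩
      Ψ L + (Dx + Dw)                                    ∎)
      where
      open ≤-Reasoning
      Dx = totdeg L⁻ x
      Dw = totdeg L⁻ w
      big-x = bad-end-weight x bad-x totdeg-x
      big-w = bad-end-weight w bad-w totdeg-w
      at-w : weight L⁻ w + weight L w ≤ (weight L w + correction w) + 0
      at-w rewrite w-repaired tight-w | +-identityʳ (weight L w + correction w) = m≤m+n (weight L w) (correction w)

    module AtTightVertex (unique : Unique L) (no-double : NoDoubleEdge L)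
                         (bad-x : isBad L x ≡ true) (tight-x : deg L s x ≡ K) where

      -- w is not (opp s)-tight when bad, since e₀ is not a double edge; hence a bad
      -- w stays bad, a good w stays good, and x is the only newly good vertex.
      w-big : isBad L w ≡ true → K < deg L (opp s) w
      w-big bad-w = ≤∧≢⇒< (bad⇒K≤deg L w bad-w (opp s))
                          (λ K≡ → no-double s e₀ (∈-lookup i) (bad-x , bad-w , tight-x , sym K≡))

      w-stays-bad : isBad L w ≡ true → isBad L⁻ w ≡ true
      w-stays-bad bad-w = K≤deg⇒bad L⁻ w s (subst (K ≤_) (deg-away s w x≢w) (bad⇒K≤deg L w bad-w s))
                                            (s≤s⁻¹ (subst (suc K ≤_) (deg-end (opp s)) (w-big bad-w)))

      w-stays-good : isBad L w ≡ false → isBad L⁻ w ≡ false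
      w-stays-good good-w with isBad L⁻ w in bad⁻
      ... | false = refl
      ... | true  = ⊥-elim (false≢true (trans (sym good-w) (isBad-removeAt w bad⁻)))

      newlyGood-x : ∀ u → newlyGood u ≡ true → u ≡ x
      newlyGood-x u newly with newlyGood-end u newly
      ... | inj₁ u≡x = u≡x
      ... | inj₂ refl with isBad L w in bad-w
      ...   | true  = ⊥-elim (false≢true (trans (sym (cong (λ b → true ∧ not b) (w-stays-bad bad-w))) newly))
      ...   | false = ⊥-elim (false≢true newly)

      -- The feeding s-edges run from x to bad s-tight vertices, and there are no
      -- feeding (opp s)-edges; so the correction is bounded by `tightBadEdges L s x`.
      Feeds-s : count (Feeds s) L⁻ ≤ tightBadEdges L s x
      Feeds-s = ≤-trans (count-mono (Feeds s) _ L⁻ from-tight-bad) (count-removeAt _ L i)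
        where
        from-tight-bad : ∀ e → e ∈ L⁻ → Feeds s e ≡ true →
                         (does (end (opp s) e ≟ x) ∧ (isBad L (end s e) ∧ isTight L s (end s e))) ≡ true
        from-tight-bad e e∈ feeds with ∧-true⇒ {isBad L⁻ (end s e) ∧ isTight L⁻ s (end s e)} feeds
        ... | bad-tight , newly with ∧-true⇒ {isBad L⁻ (end s e)} bad-tight | newlyGood-x (end (opp s) e) newly
        ...   | bad⁻ , tight⁻ | at-x =
          true-∧ (dec-true (end (opp s) e ≟ x) at-x)
                 (true-∧ (isBad-removeAt (end s e) bad⁻)
                         (trans (cong (λ a → does (a ℕ-≟ K)) (deg-away s (end s e) x≢end)) tight⁻))
          where
          x≢end : x ≢ end s e
          x≢end x≡ = ends-differ e (All.lookup loopless (∈-removeAt⁻ L i e∈)) s (trans (sym x≡) (sym at-x))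

      Feeds-opp : count (Feeds (opp s)) L⁻ ≡ 0
      Feeds-opp = count-none (Feeds (opp s)) L⁻ impossible
        where
        -- A feeding (opp s)-edge e would run from x to a bad (opp s)-tight
        -- vertex: e₀ itself (deleted), or a double edge.
        impossible : ∀ e → e ∈ L⁻ → Feeds (opp s) e ≡ true → ⊥
        impossible e e∈ feeds with ∧-true⇒ {isBad L⁻ (end (opp s) e) ∧ isTight L⁻ (opp s) (end (opp s) e)} feeds
        ... | bad-tight , newly with ∧-true⇒ {isBad L⁻ (end (opp s) e)} bad-tight
                                   | newlyGood-x (end s e) (subst (λ σ → newlyGood (end σ e) ≡ true) (opp-involutive s) newly)
        ...   | bad⁻ , tight⁻ | at-x with end (opp s) e ≟ w
        ...     | yes at-w = Unique-removeAt-≢ L i unique e∈ (ends-determine s e e₀ at-x at-w)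
        ...     | no ¬at-w = no-double s e (∈-removeAt⁻ L i e∈)
                   (subst (λ z → isBad L z ≡ true) (sym at-x) bad-x , isBad-removeAt _ bad⁻ ,
                    trans (cong (deg L s) at-x) tight-x ,
                    trans (deg-away (opp s) (end (opp s) e) (λ w≡ → ¬at-w (sym w≡)))
                          (does-true⇒ (deg L⁻ (opp s) (end (opp s) e) ℕ-≟ K) tight⁻))

      sum-correction-x : sum correction ≤ tightBadEdges L s x
      sum-correction-x = begin
        sum correction                                        ≡⟨ sum-correction ⟩
        bothSides (λ σ → count (Feeds σ) L⁻)                  ≡⟨ bothSides-from s (λ σ → count (Feeds σ) L⁻) ⟩
        count (Feeds s) L⁻ + count (Feeds (opp s)) L⁻         ≡⟨ cong (count (Feeds s) L⁻ +_) Feeds-opp ⟩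
        count (Feeds s) L⁻ + 0                                ≡⟨ +-identityʳ _ ⟩
        count (Feeds s) L⁻                                    ≤⟨ Feeds-s ⟩
        tightBadEdges L s x                                   ∎
        where open ≤-Reasoning

      repair-good-w : isBad L w ≡ false → Ψ L⁻ + weight L x ≤ Ψ L + tightBadEdges L s x
      repair-good-w good-w = begin
        Ψ L⁻ + weight L x                      ≡⟨ cong (Ψ L⁻ +_) (sym (+-identityʳ _)) ⟩
        Ψ L⁻ + (weight L x + 0)                ≤⟨ Ψ-removeAt (x-repaired tight-x) 0 0 at-w ⟩
        (Ψ L + sum correction) + 0             ≡⟨ +-identityʳ _ ⟩
        Ψ L + sum correction                   ≤⟨ +-monoʳ-≤ (Ψ L) sum-correction-x ⟩
        Ψ L + tightBadEdges L s x              ∎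
        where
        open ≤-Reasoning
        at-w : weight L⁻ w + 0 ≤ (weight L w + correction w) + 0
        at-w rewrite weight-good L⁻ w (w-stays-good good-w) = z≤n

      -- If w is bad it stays bad and loses 2K of weight, except that its bonus
      -- on e₀'s side may grow by some d.
      w-drop : isBad L w ≡ true → ∀ d → bonusAt L⁻ (opp s) w ≤ d + correctionAt (opp s) w →
               weight L⁻ w + twoK ≤ (weight L w + correction w) + d
      w-drop bad-w d bonus-opp = begin
        weight L⁻ w + twoK
          ≡⟨ cong (_+ twoK) (trans (weight-bad L⁻ w bad⁻) (cong (twoK * totdeg L⁻ w +_) (bothSides-from s (λ σ → bonusAt L⁻ σ w)))) ⟩
        twoK * totdeg L⁻ w + (bonusAt L⁻ s w + bonusAt L⁻ (opp s) w) + twoK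
          ≤⟨ weight-shift twoK (twoK * totdeg L⁻ w) _ _ (bonusAt L s w) (bonusAt L (opp s) w)
               (correctionAt s w) (correctionAt (opp s) w) d
               (bonusAt-removeAt s w (cong (λ a → does (a ℕ-≟ K)) (deg-away s w x≢w)) bad⁻) bonus-opp ⟩
        ((twoK + twoK * totdeg L⁻ w + (bonusAt L s w + bonusAt L (opp s) w))
            + (correctionAt s w + correctionAt (opp s) w)) + d
          ≡⟨ cong (_+ d) (cong₂ _+_ (cong₂ _+_ (trans (sym (*-suc twoK (totdeg L⁻ w))) (cong (twoK *_) (sym totdeg-w)))
                                                (sym (bothSides-from s (λ σ → bonusAt L σ w))))
                                     (sym (bothSides-from s (λ σ → correctionAt σ w)))) ⟩
        ((twoK * totdeg L w + bonus L w) + correction w) + d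
          ≡⟨ cong (λ z → (z + correction w) + d) (sym (weight-bad L w bad-w)) ⟩
        (weight L w + correction w) + d ∎
        where
        open ≤-Reasoning
        bad⁻ = w-stays-bad bad-w

      -- If w is (opp s)-tight after the deletion, it has at most K good
      -- (opp s)-edges: it had K + 1 such edges, and e₀ leads to the bad vertex x.
      few-good-edges : deg L⁻ (opp s) w ≡ K → goodEdges L (opp s) w ≤ K
      few-good-edges tight⁻ = s≤s⁻¹ (begin
        suc (goodEdges L (opp s) w)                          ≡⟨ +-comm 1 _ ⟩
        goodEdges L (opp s) w + 1                            ≤⟨ +-monoʳ-≤ (goodEdges L (opp s) w) e₀-counted ⟩
        goodEdges L (opp s) w + badEdges L (opp s) w         ≡⟨ +-comm (goodEdges L (opp s) w) _ ⟩
        badEdges L (opp s) w + goodEdges L (opp s) w         ≡⟨ sym (deg-split L (opp s) w) ⟩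
        deg L (opp s) w                                      ≡⟨ deg-end (opp s) ⟩
        suc (deg L⁻ (opp s) w)                               ≡⟨ cong suc tight⁻ ⟩
        suc K                                                ∎)
        where
        open ≤-Reasoning
        e₀-counted : 1 ≤ badEdges L (opp s) w
        e₀-counted = count-≥1 (λ e → does (end (opp s) e ≟ w) ∧ isBad L (end (opp (opp s)) e)) L (∈-lookup i)
                       (true-∧ (dec-true (w ≟ w) refl) (subst (λ σ → isBad L (end σ e₀) ≡ true) (sym (opp-involutive s)) bad-x))

      w-bonus-increase : isBad L w ≡ true →
        Σ ℕ (λ d → d ≤ goodEdges L (opp s) w × d ≤ K × bonusAt L⁻ (opp s) w ≤ d + correctionAt (opp s) w)
      w-bonus-increase bad-w = by-tightness (isTight L⁻ (opp s) w) refl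
        where
        by-tightness : ∀ t → isTight L⁻ (opp s) w ≡ t →
          Σ ℕ (λ d → d ≤ goodEdges L (opp s) w × d ≤ K × bonusAt L⁻ (opp s) w ≤ d + correctionAt (opp s) w)
        by-tightness false loose = 0 , z≤n , z≤n , ≤-trans (≤-reflexive (if-false loose)) z≤n
        by-tightness true  tight = goodEdges L (opp s) w , ≤-refl ,
          few-good-edges (does-true⇒ (deg L⁻ (opp s) w ℕ-≟ K) tight) ,
          ≤-trans (≤-reflexive (if-true tight))
            (≤-trans (goodEdges-removeAt (opp s) w)
                     (≤-reflexive (cong (goodEdges L (opp s) w +_) (sym (if-true (true-∧ (w-stays-bad bad-w) tight))))))
      repair-bad-w : isBad L w ≡ true →
        Σ ℕ (λ d → d ≤ goodEdges L (opp s) w × d ≤ K × Ψ L⁻ + (weight L x + twoK) ≤ Ψ L + tightBadEdges L s x + d)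
      repair-bad-w bad-w with w-bonus-increase bad-w
      ... | d , d≤good , d≤K , bonus-opp = d , d≤good , d≤K , (begin
        Ψ L⁻ + (weight L x + twoK)              ≤⟨ Ψ-removeAt (x-repaired tight-x) twoK d (w-drop bad-w d bonus-opp) ⟩
        (Ψ L + sum correction) + (0 + d)        ≤⟨ +-monoˡ-≤ d (+-monoʳ-≤ (Ψ L) sum-correction-x) ⟩
        Ψ L + tightBadEdges L s x + d           ∎)
        where open ≤-Reasoning

  tightBad+good≤deg : ∀ L s u → tightBadEdges L s u + goodEdges L (opp s) u ≤ deg L (opp s) u
  tightBad+good≤deg L s u = begin
    tightBadEdges L s u + goodEdges L (opp s) u
      ≤⟨ +-mono-≤ (count-mono _ _ L tight-bad⇒bad) (≤-reflexive (sumL-cong L (λ e _ → cong (λ σ → 𝟙 (at-u e ∧ not (isBad L (end σ e)))) (opp-involutive s)))) ⟩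
    count (λ e → at-u e ∧ isBad L (end s e)) L + count (λ e → at-u e ∧ not (isBad L (end s e))) L
      ≡⟨ sym (count-split at-u (λ e → isBad L (end s e)) L) ⟩
    deg L (opp s) u ∎
    where
    open ≤-Reasoning
    at-u : Edge n → Bool
    at-u e = does (end (opp s) e ≟ u)
    tight-bad⇒bad : ∀ e → e ∈ L → (at-u e ∧ (isBad L (end s e) ∧ isTight L s (end s e))) ≡ true →
                    (at-u e ∧ isBad L (end s e)) ≡ true
    tight-bad⇒bad e _ h with ∧-true⇒ {at-u e} h
    ... | at , bad-tight = true-∧ at (proj₁ (∧-true⇒ {isBad L (end s e)} bad-tight))

  weight-tight : ∀ L s u → isBad L u ≡ true → deg L s u ≡ K → twoK * totdeg L u + goodEdges L s u ≤ weight L u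
  weight-tight L s u bad tight = begin
    twoK * totdeg L u + goodEdges L s u        ≡⟨ cong (twoK * totdeg L u +_) (sym (if-true (dec-true (deg L s u ℕ-≟ K) tight))) ⟩
    twoK * totdeg L u + bonusAt L s u
      ≤⟨ +-monoʳ-≤ (twoK * totdeg L u) (≤-trans (m≤m+n _ _) (≤-reflexive (sym (bothSides-from s (λ σ → bonusAt L σ u))))) ⟩
    twoK * totdeg L u + bonus L u              ≡⟨ sym (weight-bad L u bad) ⟩
    weight L u                                 ∎
    where open ≤-Reasoning

  good-edge-counted : ∀ L s x e → e ∈ L → end s e ≡ x → isBad L (end (opp s) e) ≡ false → 1 ≤ goodEdges L s x
  good-edge-counted L s x e e∈L at-x good =
    count-≥1 (λ e → does (end s e ≟ x) ∧ isGood L (end (opp s) e)) L e∈L (true-∧ (dec-true (end s e ≟ x) at-x) (cong not good))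

  edge-at : ∀ L s u → 1 ≤ deg L s u → Σ (Edge n) (λ e → e ∈ L × end s e ≡ u)
  edge-at L s u pos with count-witness (λ e → does (end s e ≟ u)) L pos
  ... | e , e∈L , at-u = e , e∈L , does-true⇒ (end s e ≟ u) at-u

  InDKK : Edges → Set
  InDKK L = ∀ v → deg L tgt v ≤ K ⊎ deg L src v ≤ K

  -- The local inequalities `repair-good` and `repair-bad` around a bad
  -- s-tight vertex x force its other degree to be K + 1 or K; the first case
  -- reduces to the second, and the second contradicts `repair-good`.

  module Stuck (L : Edges) (unique : Unique L) (loopless : Loopless L) (inDKK : InDKK L)
               (stuck : ∀ i → Ψ L < Ψ (removeAt L i) + Δ) where

    small-side : ∀ s v → deg L s v ≤ K ⊎ deg L (opp s) v ≤ K
    small-side tgt v = inDKK v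
    small-side src v with inDKK v
    ... | inj₁ small = inj₂ small
    ... | inj₂ small = inj₁ small

    no-double : NoDoubleEdge L
    no-double s e e∈L double with index-of e∈L
    ... | i , refl = <⇒≱ (stuck i) (DeletionFrom.double-deletion L i s loopless double)

    repair-good : ∀ s x e → e ∈ L → end s e ≡ x → isBad L x ≡ true → deg L s x ≡ K →
                  isBad L (end (opp s) e) ≡ false → weight L x < Δ + tightBadEdges L s x
    repair-good s x e e∈L refl bad-x tight-x good-w with index-of e∈L
    ... | i , refl = deletion-gap (stuck i)
                       (DeletionFrom.AtTightVertex.repair-good-w L i s loopless unique no-double bad-x tight-x good-w)

    repair-bad : ∀ s x e → e ∈ L → end s e ≡ x → isBad L x ≡ true → deg L s x ≡ K →
                 isBad L (end (opp s) e) ≡ true →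
                 Σ ℕ (λ d → d ≤ goodEdges L (opp s) (end (opp s) e) × d ≤ K ×
                            weight L x + twoK < Δ + (tightBadEdges L s x + d))
    repair-bad s x e e∈L refl bad-x tight-x bad-w with index-of e∈L
    ... | i , refl with DeletionFrom.AtTightVertex.repair-bad-w L i s loopless unique no-double bad-x tight-x bad-w
    ...   | d , d≤good , d≤K , bound =
      d , d≤good , d≤K , deletion-gap (stuck i) (≤-trans bound (≤-reflexive (+-assoc (Ψ L) _ d)))

    -- Step 1: a bad s-tight vertex x has (opp s)-degree at most K + 1, since
    -- otherwise it would outweigh both repair inequalities.
    opp-deg-≤ : ∀ s x → isBad L x ≡ true → deg L s x ≡ K → deg L (opp s) x ≤ suc K
    opp-deg-≤ s x bad-x tight-x with deg L (opp s) x ≤? suc K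
    ... | yes small = small
    ... | no big with edge-at L s x (≤-trans (s≤s z≤n) (≤-reflexive (sym tight-x)))
    ...   | e , e∈L , at-x = ⊥-elim (by-other-end (isBad L (end (opp s) e)) refl)
      where
      open ≤-Reasoning
      d = deg L (opp s) x
      tightBad≤d : tightBadEdges L s x ≤ d
      tightBad≤d = ≤-trans (m≤m+n _ _) (tightBad+good≤deg L s x)
      weight-x : twoK * (K + d) + goodEdges L s x ≤ weight L x
      weight-x = subst (λ t → twoK * t + goodEdges L s x ≤ weight L x)
                       (trans (bothSides-from s (λ σ → deg L σ x)) (cong (_+ d) tight-x))
                       (weight-tight L s x bad-x tight-x)
      by-other-end : (b : Bool) → isBad L (end (opp s) e) ≡ b → ⊥
      by-other-end false good-w = <⇒≱ (repair-good s x e e∈L at-x bad-x tight-x good-w) (begin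
        Δ + tightBadEdges L s x              ≤⟨ +-monoʳ-≤ Δ tightBad≤d ⟩
        Δ + d                                ≤⟨ proj₁ (heavy d (≰⇒> big)) ⟩
        twoK * (K + d) + 1                   ≤⟨ +-monoʳ-≤ (twoK * (K + d)) (good-edge-counted L s x e e∈L at-x good-w) ⟩
        twoK * (K + d) + goodEdges L s x     ≤⟨ weight-x ⟩
        weight L x                           ∎)
      by-other-end true bad-w with repair-bad s x e e∈L at-x bad-x tight-x bad-w
      ... | d′ , _ , d′≤K , bound = <⇒≱ bound (begin
        Δ + (tightBadEdges L s x + d′)       ≤⟨ +-monoʳ-≤ Δ (+-mono-≤ tightBad≤d d′≤K) ⟩
        Δ + (d + K)                          ≤⟨ proj₂ (heavy d (≰⇒> big)) ⟩
        twoK * (K + d) + twoK                ≤⟨ +-monoˡ-≤ twoK (≤-trans (m≤m+n (twoK * (K + d)) _) weight-x) ⟩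
        weight L x + twoK                    ∎)

    heavy-tight : ∀ s x → isBad L x ≡ true → deg L s x ≡ K → K < deg L (opp s) x →
                  deg L (opp s) x ≡ suc K × Δ + goodEdges L s x ≤ weight L x
    heavy-tight s x bad-x tight-x big = opp-deg , (begin
      Δ + goodEdges L s x                  ≡⟨ cong (_+ goodEdges L s x) (sym Δ-from-degrees) ⟩
      twoK * (K + suc K) + goodEdges L s x ≡⟨ cong (λ t → twoK * t + goodEdges L s x)
                                               (sym (trans (bothSides-from s (λ σ → deg L σ x)) (cong₂ _+_ tight-x opp-deg))) ⟩
      twoK * totdeg L x + goodEdges L s x  ≤⟨ weight-tight L s x bad-x tight-x ⟩
      weight L x                           ∎)
      where
      open ≤-Reasoning
      opp-deg = ≤-antisym (opp-deg-≤ s x bad-x tight-x) big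

    -- Step 2: for such x, an s-edge to a bad vertex w forces x to have more than
    -- K tight bad (opp s)-edges, and w to have a good (opp s)-edge.
    bad-neighbour : ∀ s x e → e ∈ L → end s e ≡ x → isBad L x ≡ true → deg L s x ≡ K → K < deg L (opp s) x →
                    isBad L (end (opp s) e) ≡ true →
                    suc K ≤ tightBadEdges L s x × 1 ≤ goodEdges L (opp s) (end (opp s) e)
    bad-neighbour s x e e∈L at-x bad-x tight-x big bad-w with repair-bad s x e e∈L at-x bad-x tight-x bad-w
    ... | d , d≤good , d≤K , bound = many , positive d d≤good key
      where
      open ≤-Reasoning
      tightBad≤ : tightBadEdges L s x ≤ suc K
      tightBad≤ = ≤-trans (m≤m+n _ _) (≤-trans (tightBad+good≤deg L s x)
                                               (≤-reflexive (proj₁ (heavy-tight s x bad-x tight-x big))))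
      key : twoK < tightBadEdges L s x + d
      key = +-cancelˡ-≤ Δ _ _ (begin
        Δ + suc twoK                     ≡⟨ +-suc Δ twoK ⟩
        suc (Δ + twoK)
          ≤⟨ s≤s (+-monoˡ-≤ twoK (≤-trans (m≤m+n Δ _) (proj₂ (heavy-tight s x bad-x tight-x big)))) ⟩
        suc (weight L x + twoK)          ≤⟨ bound ⟩
        Δ + (tightBadEdges L s x + d)    ∎)
      many : suc K ≤ tightBadEdges L s x
      many with tightBadEdges L s x ≤? K
      ... | no  more = ≰⇒> more
      ... | yes few  = ⊥-elim (<⇒≱ key (+-mono-≤ few d≤K))
      positive : ∀ d → d ≤ goodEdges L (opp s) (end (opp s) e) → twoK < tightBadEdges L s x + d →
                 1 ≤ goodEdges L (opp s) (end (opp s) e)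
      positive zero    _     enough = ⊥-elim (<⇒≱ enough (≤-trans (≤-reflexive (+-identityʳ _)) (≤-trans tightBad≤ K<twoK)))
      positive (suc _) d≤good _     = ≤-trans (s≤s z≤n) d≤good

    -- Step 3: such x has more than K tight bad (opp s)-edges in any case: if
    -- all its s-edges lead to good vertices, this follows from `repair-good`.
    many-tightBad : ∀ s u → isBad L u ≡ true → deg L s u ≡ K → K < deg L (opp s) u → suc K ≤ tightBadEdges L s u
    many-tightBad s u bad-u tight-u big with 1 ≤? badEdges L s u
    ... | yes some with count-witness (λ e → does (end s e ≟ u) ∧ isBad L (end (opp s) e)) L some
    ...   | e , e∈L , at-u-bad with ∧-true⇒ {does (end s e ≟ u)} at-u-bad
    ...     | at-u , bad-w = proj₁ (bad-neighbour s u e e∈L (does-true⇒ (end s e ≟ u) at-u) bad-u tight-u big bad-w)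
    many-tightBad s u bad-u tight-u big | no none with edge-at L s u (≤-trans (s≤s z≤n) (≤-reflexive (sym tight-u)))
    ... | e , e∈L , at-u = +-cancelˡ-≤ Δ _ _ (begin
      Δ + suc K                          ≡⟨ +-suc Δ K ⟩
      suc (Δ + K)
        ≤⟨ s≤s (≤-trans (+-monoʳ-≤ Δ (≤-reflexive all-good)) (proj₂ (heavy-tight s u bad-u tight-u big))) ⟩
      suc (weight L u)                   ≤⟨ repair-good s u e e∈L at-u bad-u tight-u good-w ⟩
      Δ + tightBadEdges L s u            ∎)
      where
      open ≤-Reasoning
      no-bad-edges : badEdges L s u ≡ 0
      no-bad-edges = n≤0⇒n≡0 (s≤s⁻¹ (≰⇒> none))
      all-good : K ≡ goodEdges L s u
      all-good = trans (sym tight-u) (trans (deg-split L s u) (cong (_+ goodEdges L s u) no-bad-edges))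
      good-w : isBad L (end (opp s) e) ≡ false
      good-w with isBad L (end (opp s) e) in bad-w
      ... | false = refl
      ... | true  = ⊥-elim (<⇒≱ (s≤s z≤n)
                      (≤-trans (count-≥1 (λ e → does (end s e ≟ u) ∧ isBad L (end (opp s) e)) L e∈L
                                         (true-∧ (dec-true (end s e ≟ u) at-u) bad-w))
                               (≤-reflexive no-bad-edges)))

    -- The other end w of an s-edge at a bad s-tight vertex, when bad, is
    -- s-tight with (opp s)-degree above K, since e is not a double edge.
    bad-other-end : ∀ s e → e ∈ L → isBad L (end s e) ≡ true → deg L s (end s e) ≡ K →
                    isBad L (end (opp s) e) ≡ true →
                    K < deg L (opp s) (end (opp s) e) × deg L s (end (opp s) e) ≡ K
    bad-other-end s e e∈L bad-x tight-x bad-w = big , tight-w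
      where
      big : K < deg L (opp s) (end (opp s) e)
      big = ≤∧≢⇒< (bad⇒K≤deg L _ bad-w (opp s)) (λ K≡ → no-double s e e∈L (bad-x , bad-w , tight-x , sym K≡))
      tight-w : deg L s (end (opp s) e) ≡ K
      tight-w with small-side s (end (opp s) e)
      ... | inj₁ small = ≤-antisym small (bad⇒K≤deg L _ bad-w s)
      ... | inj₂ small = ⊥-elim (<⇒≱ big small)

    -- Step 4: a bad s-tight vertex x with (opp s)-degree above K has no s-edge
    -- to a bad vertex w: otherwise w would, by Steps 1-3, have more than K + 1
    -- edges on side (opp s).
    no-bad-neighbour : ∀ s x e → e ∈ L → end s e ≡ x → isBad L x ≡ true → deg L s x ≡ K → K < deg L (opp s) x →
                       isBad L (end (opp s) e) ≡ true → ⊥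
    no-bad-neighbour s x e e∈L at-x bad-x tight-x big bad-w = <⇒≱ (s≤s z≤n) (≤-trans (+-cancelˡ-≤ (suc K) _ _ (begin
        suc K + 1                                              ≤⟨ +-mono-≤ (many-tightBad s w bad-w tight-w big-w) good-w ⟩
        tightBadEdges L s w + goodEdges L (opp s) w           ≤⟨ tightBad+good≤deg L s w ⟩
        deg L (opp s) w                                        ≤⟨ opp-deg-≤ s w bad-w tight-w ⟩
        suc K                                                  ≡⟨ sym (+-identityʳ (suc K)) ⟩
        suc K + 0                                              ∎)) z≤n)
      where
      open ≤-Reasoning
      w = end (opp s) e
      good-w = proj₂ (bad-neighbour s x e e∈L at-x bad-x tight-x big bad-w)
      other = bad-other-end s e e∈L (subst (λ z → isBad L z ≡ true) (sym at-x) bad-x)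
                                    (trans (cong (deg L s) at-x) tight-x) bad-w
      big-w = proj₁ other
      tight-w = proj₂ other

    BalancedBad : Fin n → Set
    BalancedBad u = isBad L u ≡ true × (∀ σ → deg L σ u ≡ K)

    balanced : ∀ u s → isBad L u ≡ true → deg L s u ≡ K → deg L (opp s) u ≡ K → BalancedBad u
    balanced u tgt bad in-K out-K = bad , λ { tgt → in-K ; src → out-K }
    balanced u src bad out-K in-K = bad , λ { tgt → in-K ; src → out-K }

    -- Step 5: for such x, all (opp s)-edges come from balanced bad vertices; in
    -- particular none comes from a good vertex.
    fed-by-balanced : ∀ s x → isBad L x ≡ true → deg L s x ≡ K → K < deg L (opp s) x →
                      goodEdges L (opp s) x ≡ 0 × (∀ e → e ∈ L → end (opp s) e ≡ x → BalancedBad (end s e))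
    fed-by-balanced s x bad-x tight-x big = no-good , from-balanced
      where
      heavy-x = heavy-tight s x bad-x tight-x big
      many = many-tightBad s x bad-x tight-x big
      no-good : goodEdges L (opp s) x ≡ 0
      no-good = n≤0⇒n≡0 (+-cancelˡ-≤ (suc K) _ _
                  (≤-trans (+-monoˡ-≤ _ many) (≤-trans (tightBad+good≤deg L s x)
                    (≤-reflexive (trans (proj₁ heavy-x) (sym (+-identityʳ _)))))))
      all-tightBad : tightBadEdges L s x ≡ deg L (opp s) x
      all-tightBad = ≤-antisym (≤-trans (m≤m+n _ _) (tightBad+good≤deg L s x))
                               (≤-trans (≤-reflexive (proj₁ heavy-x)) many)
      from-balanced : ∀ e → e ∈ L → end (opp s) e ≡ x → BalancedBad (end s e)
      from-balanced e e∈L at-x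
        with ∧-true⇒ {isBad L (end s e)} (count-refine-full (λ e → does (end (opp s) e ≟ x))
               (λ e → isBad L (end s e) ∧ isTight L s (end s e)) L all-tightBad e e∈L (dec-true (end (opp s) e ≟ x) at-x))
      ... | bad-u , tight-u′ = balanced (end s e) s bad-u tight-u opp-K
        where
        tight-u : deg L s (end s e) ≡ K
        tight-u = does-true⇒ (deg L s (end s e) ℕ-≟ K) tight-u′
        opp-K : deg L (opp s) (end s e) ≡ K
        opp-K with deg L (opp s) (end s e) ≤? K
        ... | yes small = ≤-antisym small (bad⇒K≤deg L _ bad-u (opp s))
        ... | no  more  = ⊥-elim (no-bad-neighbour s (end s e) e e∈L refl bad-u tight-u (≰⇒> more)
                                   (subst (λ z → isBad L z ≡ true) (sym at-x) bad-x))

    -- Step 6: there is no balanced bad vertex z.  No tight bad vertex sends an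
    -- edge to z (it would be a double edge), and every neighbour of z is good
    -- (by Step 5 and `repair-bad`); so z weighs exactly Δ, which contradicts
    -- `repair-good`.
    no-balanced-bad : ∀ z → BalancedBad z → ⊥
    no-balanced-bad z (bad-z , deg-K) with edge-at L tgt z (≤-trans (s≤s z≤n) (≤-reflexive (sym (deg-K tgt))))
    ... | e , e∈L , at-z = <⇒≱ (repair-good tgt z e e∈L at-z bad-z (deg-K tgt) (neighbours-good tgt e e∈L at-z)) (begin
        Δ + tightBadEdges L tgt z        ≡⟨ cong (Δ +_) (no-tightBad tgt) ⟩
        Δ + 0                            ≡⟨ +-identityʳ Δ ⟩
        Δ                                ≡⟨ sym Δ-from-balanced ⟩
        twoK * (K + K) + (K + K)         ≡⟨ cong₂ (λ d b → twoK * d + b) (sym (cong₂ _+_ (deg-K tgt) (deg-K src)))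
                                                                          (sym (cong₂ _+_ (bonus-K tgt) (bonus-K src))) ⟩
        twoK * totdeg L z + bonus L z    ≡⟨ sym (weight-bad L z bad-z) ⟩
        weight L z                       ∎)
      where
      open ≤-Reasoning
      no-tightBad : ∀ s → tightBadEdges L s z ≡ 0
      no-tightBad s = count-none _ L double
        where
        double : ∀ e → e ∈ L → (does (end (opp s) e ≟ z) ∧ (isBad L (end s e) ∧ isTight L s (end s e))) ≡ true → ⊥
        double e e∈L h with ∧-true⇒ {does (end (opp s) e ≟ z)} h
        ... | at , bad-tight with ∧-true⇒ {isBad L (end s e)} bad-tight | does-true⇒ (end (opp s) e ≟ z) at
        ...   | bad-u , tight-u | refl = no-double s e e∈L
                 (bad-u , bad-z , does-true⇒ (deg L s (end s e) ℕ-≟ K) tight-u , deg-K (opp s))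
      neighbours-good : ∀ s e → e ∈ L → end s e ≡ z → isBad L (end (opp s) e) ≡ false
      neighbours-good s e e∈L at-z with isBad L (end (opp s) e) in bad-w
      ... | false = refl
      ... | true with bad-other-end s e e∈L (subst (λ u → isBad L u ≡ true) (sym at-z) bad-z)
                                           (trans (cong (deg L s) at-z) (deg-K s)) bad-w
      ...   | big-w , tight-w with fed-by-balanced s (end (opp s) e) bad-w tight-w big-w
                                 | repair-bad s z e e∈L at-z bad-z (deg-K s) bad-w
      ...     | no-good , _ | d , d≤good , _ , bound = ⊥-elim (<⇒≱ bound (begin
        Δ + (tightBadEdges L s z + d)
          ≡⟨ cong₂ (λ a b → Δ + (a + b)) (no-tightBad s) (n≤0⇒n≡0 (≤-trans d≤good (≤-reflexive no-good))) ⟩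
        Δ + 0                            ≡⟨ +-identityʳ Δ ⟩
        Δ                                ≡⟨ sym Δ-from-balanced ⟩
        twoK * (K + K) + twoK            ≡⟨ cong (λ d → twoK * d + twoK) (sym (cong₂ _+_ (deg-K tgt) (deg-K src))) ⟩
        twoK * totdeg L z + twoK
          ≤⟨ +-monoˡ-≤ twoK (≤-trans (m≤m+n _ (bonus L z)) (≤-reflexive (sym (weight-bad L z bad-z)))) ⟩
        weight L z + twoK                ∎))
      bonus-K : ∀ s → bonusAt L s z ≡ K
      bonus-K s = begin-equality
        bonusAt L s z                         ≡⟨ if-true (dec-true (deg L s z ℕ-≟ K) (deg-K s)) ⟩
        goodEdges L s z                       ≡⟨ sym (cong (_+ goodEdges L s z) no-bad-edges) ⟩
        badEdges L s z + goodEdges L s z      ≡⟨ sym (deg-split L s z) ⟩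
        deg L s z                             ≡⟨ deg-K s ⟩
        K                                     ∎
        where
        no-bad-edges : badEdges L s z ≡ 0
        no-bad-edges = count-none _ L (λ e e∈L h → let (at , bad-w) = ∧-true⇒ {does (end s e ≟ z)} h in
                         false≢true (trans (sym (neighbours-good s e e∈L (does-true⇒ (end s e ≟ z) at))) bad-w))

    tight-side : ∀ v → isBad L v ≡ true → Σ Side (λ s → deg L s v ≡ K)
    tight-side v bad-v with inDKK v
    ... | inj₁ small = tgt , ≤-antisym small (bad⇒K≤deg L v bad-v tgt)
    ... | inj₂ small = src , ≤-antisym small (bad⇒K≤deg L v bad-v src)

    -- Step 7: there is no bad vertex.  A bad vertex v, tight on side s, is
    -- balanced, or by Step 5 it receives an edge from a balanced bad vertex.
    -- Both contradict Step 6.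
    no-bad : ∀ v → isBad L v ≡ true → ⊥
    no-bad v bad-v with tight-side v bad-v
    ... | s , tight-v with deg L (opp s) v ≤? K
    ...   | yes small = no-balanced-bad v (balanced v s bad-v tight-v (≤-antisym small (bad⇒K≤deg L v bad-v (opp s))))
    ...   | no  more with edge-at L (opp s) v (≤-trans (s≤s z≤n) (≰⇒> more))
    ...     | e , e∈L , at-v = no-balanced-bad (end s e) (proj₂ (fed-by-balanced s v bad-v tight-v (≰⇒> more)) e e∈L at-v)

  good-deletion : ∀ L → Unique L → Loopless L → InDKK L → ∀ v → isBad L v ≡ true →
                  Σ (Fin (length L)) (λ i → Ψ (removeAt L i) + Δ ≤ Ψ L)
  good-deletion L unique loopless inDKK v bad-v with any? (λ i → Ψ (removeAt L i) + Δ ≤? Ψ L)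
  ... | yes found = found
  ... | no  none  = ⊥-elim (Stuck.no-bad L unique loopless inDKK (λ i → ≰⇒> (λ ok → none (i , ok))) v bad-v)

  -- Initially Ψ ≤ 4K·m: every edge e charges each of its ends σ at most 2K
  -- (2K if that end is bad, plus 1 if the other end is good), and a bad end
  -- pays at most 2K + 1 only when the other end is good and thus uncharged.

  charge : Edges → Side → Edge n → ℕ
  charge L σ e = (if isBad L (end σ e) then twoK else 0) + 𝟙 (isGood L (end (opp σ) e))

  charges-at : ∀ L σ v → isBad L v ≡ true →
               twoK * deg L σ v + bonusAt L σ v ≤ sumL (λ e → at (end σ e) (charge L σ e) v) L
  charges-at L σ v bad = begin
    twoK * deg L σ v + bonusAt L σ v
      ≤⟨ +-monoʳ-≤ (twoK * deg L σ v) bonus≤ ⟩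
    twoK * deg L σ v + goodEdges L σ v
      ≡⟨ cong (_+ goodEdges L σ v) (sym (count-if (λ e → does (end σ e ≟ v)) twoK L)) ⟩
    sumL (λ e → if does (end σ e ≟ v) then twoK else 0) L + goodEdges L σ v
      ≡⟨ sym (sumL-+ (λ e → if does (end σ e ≟ v) then twoK else 0)
                     (λ e → 𝟙 (does (end σ e ≟ v) ∧ isGood L (end (opp σ) e))) L) ⟩
    sumL (λ e → (if does (end σ e ≟ v) then twoK else 0) + 𝟙 (does (end σ e ≟ v) ∧ isGood L (end (opp σ) e))) L
      ≡⟨ sumL-cong L (λ e _ → pointwise e) ⟩
    sumL (λ e → at (end σ e) (charge L σ e) v) L ∎
    where
    open ≤-Reasoning
    bonus≤ : bonusAt L σ v ≤ goodEdges L σ v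
    bonus≤ with isTight L σ v
    ... | true  = ≤-refl
    ... | false = z≤n
    pointwise : ∀ e → (if does (end σ e ≟ v) then twoK else 0) + 𝟙 (does (end σ e ≟ v) ∧ isGood L (end (opp σ) e))
                      ≡ at (end σ e) (charge L σ e) v
    pointwise e with end σ e ≟ v
    ... | yes refl rewrite bad = refl
    ... | no _     = refl

  weight-≤-charges : ∀ L v → weight L v ≤ bothSides (λ σ → sumL (λ e → at (end σ e) (charge L σ e) v) L)
  weight-≤-charges L v = by-badness (isBad L v) refl
    where
    by-badness : ∀ b → isBad L v ≡ b → weight L v ≤ bothSides (λ σ → sumL (λ e → at (end σ e) (charge L σ e) v) L)
    by-badness false good = ≤-trans (≤-reflexive (weight-good L v good)) z≤n
    by-badness true  bad  = begin
      weight L v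
        ≡⟨ weight-bad L v bad ⟩
      twoK * (deg L tgt v + deg L src v) + (bonusAt L tgt v + bonusAt L src v)
        ≡⟨ cong (_+ bonus L v) (*-distribˡ-+ twoK (deg L tgt v) (deg L src v)) ⟩
      (twoK * deg L tgt v + twoK * deg L src v) + (bonusAt L tgt v + bonusAt L src v)
        ≡⟨ interchange (twoK * deg L tgt v) (twoK * deg L src v) (bonusAt L tgt v) (bonusAt L src v) ⟩
      (twoK * deg L tgt v + bonusAt L tgt v) + (twoK * deg L src v + bonusAt L src v)
        ≤⟨ +-mono-≤ (charges-at L tgt v bad) (charges-at L src v bad) ⟩
      bothSides (λ σ → sumL (λ e → at (end σ e) (charge L σ e) v) L) ∎
      where open ≤-Reasoning

  charge-total : ∀ L e → bothSides (λ σ → charge L σ e) ≤ twoK + twoK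
  charge-total L e = ≤-trans (≤-reflexive (regroup (if isBad L (end tgt e) then twoK else 0) (𝟙 (isGood L (end src e)))
                                                   (if isBad L (end src e) then twoK else 0) (𝟙 (isGood L (end tgt e)))))
                             (+-mono-≤ (one-end (isBad L (end tgt e))) (one-end (isBad L (end src e))))
    where
    regroup : ∀ a b c d → (a + b) + (c + d) ≡ (a + d) + (c + b)
    regroup a b c d = trans (cong ((a + b) +_) (+-comm c d))
                            (trans (interchange a b d c) (cong ((a + d) +_) (+-comm b c)))
    one-end : (b : Bool) → (if b then twoK else 0) + 𝟙 (not b) ≤ twoK
    one-end true  = ≤-reflexive (+-identityʳ twoK)
    one-end false = s≤s z≤n

  potential-bound : ∀ L → Ψ L ≤ twoK * (length L + length L)
  potential-bound L = begin
    Ψ L                                                          ≤⟨ sum-mono (weight-≤-charges L) ⟩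
    sum (λ v → bothSides (λ σ → sumL (λ e → at (end σ e) (charge L σ e) v) L))
      ≡⟨ ∑-distrib-+ (λ v → sumL (λ e → at (end tgt e) (charge L tgt e) v) L) _ ⟩
    bothSides (λ σ → sum (λ v → sumL (λ e → at (end σ e) (charge L σ e) v) L))
      ≡⟨ cong₂ _+_ (per-side tgt) (per-side src) ⟩
    bothSides (λ σ → sumL (charge L σ) L)                        ≡⟨ sym (sumL-+ (charge L tgt) (charge L src) L) ⟩
    sumL (λ e → bothSides (λ σ → charge L σ e)) L                ≤⟨ sumL-mono L (λ e _ → charge-total L e) ⟩
    sumL (λ _ → twoK + twoK) L                                   ≡⟨ sumL-const (twoK + twoK) L ⟩
    length L * (twoK + twoK)                                     ≡⟨ trans (*-comm (length L) (twoK + twoK))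
                                                                     (trans (*-distribʳ-+ (length L) twoK twoK)
                                                                            (sym (*-distribˡ-+ twoK (length L) (length L)))) ⟩
    twoK * (length L + length L)                                 ∎
    where
    open ≤-Reasoning
    per-side : ∀ σ → sum (λ v → sumL (λ e → at (end σ e) (charge L σ e) v) L) ≡ sumL (charge L σ) L
    per-side σ = trans (sum-sumL (λ e v → at (end σ e) (charge L σ e) v) L)
                       (sumL-cong L (λ e _ → sum-at (end σ e) (charge L σ e)))

  deletion-count : ∀ m m′ → Δ * m ≤ Δ * m′ + twoK * (m + m) → (2 * k + 1) * m ≤ (2 * k + 3) * m′
  deletion-count m m′ bound = +-cancelʳ-≤ (m + m) _ _ (*-cancelˡ-≤ twoK (begin
    twoK * ((2 * k + 1) * m + (m + m))   ≡⟨ identity₁ k m ⟩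
    Δ * m                                ≤⟨ bound ⟩
    Δ * m′ + twoK * (m + m)              ≡⟨ identity₂ k m′ m ⟩
    twoK * ((2 * k + 3) * m′ + (m + m))  ∎))
    where
    open ≤-Reasoning
    identity₁ : ∀ k m → (suc k + suc k) * ((2 * k + 1) * m + (m + m)) ≡ (suc k + suc k) * ((suc k + suc k) + 1) * m
    identity₁ = solve-∀
    identity₂ : ∀ k m′ m → (suc k + suc k) * ((suc k + suc k) + 1) * m′ + (suc k + suc k) * (m + m)
                           ≡ (suc k + suc k) * ((2 * k + 3) * m′ + (m + m))
    identity₂ = solve-∀

  -- Repeated good deletions.  The result keeps a sub-list without bad
  -- vertices and pays Δ per deleted edge out of the initial potential.
  record Repaired (L : Edges) : Set where
    field
      kept     : Edges
      kept⊆L   : ∀ {e} → e ∈ kept → e ∈ L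
      kept-unique   : Unique kept
      kept-loopless : Loopless kept
      kept-in-Dkk   : ∀ v → deg kept tgt v ≤ k ⊎ deg kept src v ≤ k
      paid          : Δ * length L ≤ Δ * length kept + Ψ L

  no-bad⇒in-Dkk : ∀ L → (∀ v → isBad L v ≢ true) → ∀ v → deg L tgt v ≤ k ⊎ deg L src v ≤ k
  no-bad⇒in-Dkk L no-bad v with good⇒deg<K L v (¬-not (no-bad v))
  ... | tgt , small = inj₁ (s≤s⁻¹ small)
  ... | src , small = inj₂ (s≤s⁻¹ small)

  InDKK-removeAt : ∀ L i → InDKK L → InDKK (removeAt L i)
  InDKK-removeAt L i inDKK v with inDKK v
  ... | inj₁ small = inj₁ (≤-trans (Deletion.deg-≤ L i tgt v) small)
  ... | inj₂ small = inj₂ (≤-trans (Deletion.deg-≤ L i src v) small)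

  repair : ∀ f L → length L ≤ f → Unique L → Loopless L → InDKK L → Repaired L
  repair f L small unique loopless inDKK with any? (λ v → isBad L v Bool-≟ true)
  ... | no  no-bad = record { kept = L ; kept⊆L = λ e∈ → e∈ ; kept-unique = unique ; kept-loopless = loopless
                            ; kept-in-Dkk = no-bad⇒in-Dkk L (λ v bad → no-bad (v , bad)) ; paid = m≤m+n _ _ }
  ... | yes (v , bad) with good-deletion L unique loopless inDKK v bad | f
  ...   | i , dropped | zero = ⊥-elim (<⇒≱ (≤-trans (s≤s z≤n) (≤-reflexive (sym (length-removeAt′ L i)))) small)
  ...   | i , dropped | suc f′ = record
          { kept = kept ; kept⊆L = λ e∈ → ∈-removeAt⁻ L i (kept⊆L e∈) ; kept-unique = kept-unique
          ; kept-loopless = kept-loopless ; kept-in-Dkk = kept-in-Dkk ; paid = paid′ }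
    where
    rest = repair f′ (removeAt L i) (s≤s⁻¹ (≤-trans (≤-reflexive (sym (length-removeAt′ L i))) small))
                  (Unique-removeAt L i unique) (All-removeAt L i loopless) (InDKK-removeAt L i inDKK)
    open Repaired rest renaming (paid to paid-rest)
    open ≤-Reasoning
    paid′ : Δ * length L ≤ Δ * length kept + Ψ L
    paid′ = begin
      Δ * length L                              ≡⟨ cong (Δ *_) (length-removeAt′ L i) ⟩
      Δ * suc (length (removeAt L i))           ≡⟨ *-suc Δ _ ⟩
      Δ + Δ * length (removeAt L i)             ≤⟨ +-monoʳ-≤ Δ paid-rest ⟩
      Δ + (Δ * length kept + Ψ (removeAt L i))  ≡⟨ x∙yz≈y∙zx Δ (Δ * length kept) _ ⟩
      Δ * length kept + (Ψ (removeAt L i) + Δ)  ≤⟨ +-monoʳ-≤ (Δ * length kept) dropped ⟩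
      Δ * length kept + Ψ L                     ∎

indeg≡deg : ∀ k {n} (D : Digraph n) v → indeg D v ≡ Potential.deg k n (edges D) tgt v
indeg≡deg k D v = length-filter≡count (λ e → proj₂ e ≟ v) (edges D)

outdeg≡deg : ∀ k {n} (D : Digraph n) v → outdeg D v ≡ Potential.deg k n (edges D) src v
outdeg≡deg k D v = length-filter≡count (λ e → proj₁ e ≟ v) (edges D)

-- Repair D by good deletions; Δ·(edges deleted)
-- is bounded by the initial potential, which is at most 4K·m.
theorem10 : (k : ℕ) → {n : ℕ} → (D : Digraph n) → InDkl (suc k) (suc k) D →
    Σ (Digraph n) (λ H → H ⊑ D × InDkl k k H ×
    ((2 * k + 1) * size D ≤ (2 * k + 3) * size H))
theorem10 k {n} D D∈ = H , kept⊆L , H∈ , deletion-count (size D) (size H) paid-bound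
  where
  open Potential k n
  inDKK : InDKK (edges D)
  inDKK v with D∈ v
  ... | inj₁ small = inj₁ (subst (_≤ K) (indeg≡deg k D v) small)
  ... | inj₂ small = inj₂ (subst (_≤ K) (outdeg≡deg k D v) small)
  open Repaired (repair (size D) (edges D) ≤-refl (simple D) (loopless D) inDKK)
  H : Digraph n
  H = digraph kept kept-loopless kept-unique
  H∈ : InDkl k k H
  H∈ v with kept-in-Dkk v
  ... | inj₁ small = inj₁ (subst (_≤ k) (sym (indeg≡deg k H v)) small)
  ... | inj₂ small = inj₂ (subst (_≤ k) (sym (outdeg≡deg k H v)) small)
  paid-bound : Δ * size D ≤ Δ * size H + twoK * (size D + size D)
  paid-bound = ≤-trans paid (+-monoʳ-≤ (Δ * size H) (potential-bound (edges D)))
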